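{- Let $a,k,r$ be non-negative integers with $a<k<r$. Then for every integer $n\ge r$, \[ g^{(k)}_{\{0,1,\dots,a\}}(n)\ \ge\ g^{(r)}_{\{0,1,\dots,a\}}(n)\ \ge\ g^{(k)}_{\{0,1,\dots,a\}}(n-r+k), \] and for every integer $n\ge r-k$, \[ h^{(k)}_{\{0,1,\dots,a\}}(n)\ \ge\ h^{(r)}_{\{0,1,\dots,a\}}(n)\ \ge\ h^{(k)}_{\{0,1,\dots,a\}}(n-r+k). \]
   Context: An $r$-uniform hypergraph is a finite vertex set with a family of $r$-element subsets (hyperedges). A vertex is isolated if it lies in no hyperedge. Given a non-empty set $A$ of non-negative integers, a set $S$ of vertices is an $A$-transversal of an $r$-uniform hypergraph $\mathcal{H}$ if $|H\cap S|\in A$ for every hyperedge $H$; it is maximal if it is not a proper subset of another $A$-transversal. For $n\ge r$, $g^{(r)}_A(n)$ denotes the maximum number of $A$-transversals in an $r$-uniform hypergraph on $n$ vertices with no isolated vertices, and $h^{(r)}_A(n)$ denotes the maximum number of maximal $A$-transversals in an $r$-uniform hypergraph on $n$ vertices (isolated vertices allowed). -}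

module Defs where

open import Data.Bool using (Bool; true; false; _∧_; _∨_; not)
open import Data.Nat using (ℕ; zero; suc; _≤_; _≤ᵇ_)
open import Data.Fin using (Fin)
open import Data.Fin.Subset using (Subset; inside; outside; _∩_; ∣_∣; _∈_)
open import Data.Vec using (Vec; []; _∷_)
open import Data.List using (List; [];  _∷_; map; _++_; length; filterᵇ)
open import Data.Bool.ListAction using (all; any)
open import Data.List.Relation.Unary.All using (All)
open import Data.List.Relation.Unary.Any using (Any)
open import Data.Product using (Σ; _×_)
open import Relation.Binary.PropositionalEquality using (_≡_)

allSubsets : (n : ℕ) → List (Subset n)
allSubsets zero = [] ∷ []
allSubsets (suc n) = map (inside ∷_) (allSubsets n) ++ map (outside ∷_) (allSubsets n)

-- A hypergraph on vertex set Fin n: a (finite) family of hyperedges.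
-- (Repeated entries in the list are irrelevant for everything below.)
Hypergraph : ℕ → Set
Hypergraph n = List (Subset n)

Uniform : {n : ℕ} → ℕ → Hypergraph n → Set
Uniform r H = All (λ e → ∣ e ∣ ≡ r) H

NoIsolated : {n : ℕ} → Hypergraph n → Set
NoIsolated {n} H = (v : Fin n) → Any (λ e → v ∈ e) H

_⊆ᵇ_ : {n : ℕ} → Subset n → Subset n → Bool
[] ⊆ᵇ [] = true
(x ∷ s) ⊆ᵇ (y ∷ t) = (not x ∨ y) ∧ (s ⊆ᵇ t)

_≡ᵇ_ : {n : ℕ} → Subset n → Subset n → Bool
[] ≡ᵇ [] = true
(true ∷ s) ≡ᵇ (true ∷ t) = s ≡ᵇ t
(false ∷ s) ≡ᵇ (false ∷ t) = s ≡ᵇ t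
(true ∷ s) ≡ᵇ (false ∷ t) = false
(false ∷ s) ≡ᵇ (true ∷ t) = false

_⊂ᵇ_ : {n : ℕ} → Subset n → Subset n → Bool
s ⊂ᵇ t = (s ⊆ᵇ t) ∧ not (s ≡ᵇ t)

-- S is an A-transversal of H for A = {0,1,...,a}: |e ∩ S| ∈ A for all e ∈ H.
IsTransversal : {n : ℕ} → ℕ → Hypergraph n → Subset n → Bool
IsTransversal a H S = all (λ e → ∣ e ∩ S ∣ ≤ᵇ a) H

IsMaximalTransversal : {n : ℕ} → ℕ → Hypergraph n → Subset n → Bool
IsMaximalTransversal {n} a H S =
  IsTransversal a H S ∧ not (any (λ T → (S ⊂ᵇ T) ∧ IsTransversal a H T) (allSubsets n))

numTransversals : {n : ℕ} → ℕ → Hypergraph n → ℕ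
numTransversals {n} a H = length (filterᵇ (IsTransversal a H) (allSubsets n))

numMaximalTransversals : {n : ℕ} → ℕ → Hypergraph n → ℕ
numMaximalTransversals {n} a H = length (filterᵇ (IsMaximalTransversal a H) (allSubsets n))

-- m = g^{(r)}_{{0..a}}(n): m is the maximum of numTransversals over r-uniform
-- hypergraphs on n vertices without isolated vertices (attained and an upper bound).
IsG : (r a n m : ℕ) → Set
IsG r a n m =
  Σ (Hypergraph n) (λ H → Uniform r H × NoIsolated H × numTransversals a H ≡ m)
  × ((H : Hypergraph n) → Uniform r H → NoIsolated H → numTransversals a H ≤ m)

-- m = h^{(r)}_{{0..a}}(n): maximum of numMaximalTransversals over r-uniform
-- hypergraphs on n vertices (isolated vertices allowed).
IsH : (r a n m : ℕ) → Set
IsH r a n m =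
  Σ (Hypergraph n) (λ H → Uniform r H × numMaximalTransversals a H ≡ m)
  × ((H : Hypergraph n) → Uniform r H → numMaximalTransversals a H ≤ m)

-- Write A = {0,…,a} with a < k ≤ r.
--
-- Upper bounds: the k-shadow of an r-uniform hypergraph (all k-subsets of its
-- edges) has exactly the same A-transversals, because an edge meets S in more
-- than a vertices iff one of its k-subsets does; it also keeps every vertex
-- covered. Hence so do the maximal A-transversals, and g⁽ʳ⁾ ≤ g⁽ᵏ⁾, h⁽ʳ⁾ ≤ h⁽ᵏ⁾.
--
-- Lower bounds: adding the same r − k new vertices to every edge of a
-- k-uniform hypergraph on n − r + k vertices gives an r-uniform hypergraph on
-- n vertices, and every (maximal) A-transversal S extends injectively by
-- leaving the new vertices out. Maximality survives because a maximal
-- transversal of a nonempty hypergraph whose edges exceed a vertices meets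
-- some edge in a vertices (else some vertex could be added), and that edge
-- becomes overfull as soon as a new vertex is added. The empty hypergraph is
-- the exception: its only maximal transversal is everything, so it takes the
-- new vertices in.

module Submission where

open import Defs
open import Data.Bool using (Bool; true; false; T; _∧_; not)
open import Data.Bool.ListAction using (any)
open import Data.Bool.Properties using (T-∧)
open import Data.Nat using (ℕ; zero; suc; _≤_; _<_; _≥_; _+_; _∸_; z≤n; s≤s; _≟_)
open import Data.Nat.Properties
  using ( ≤ᵇ⇒≤; ≤⇒≤ᵇ; _≤?_; ≤-refl; ≤-reflexive; ≤-antisym; ≤-trans; ≤-<-trans; <-≤-trans
        ; ≤-pred; <⇒≤; ≰⇒>; ≮⇒≥; <⇒≱; n≤1+n; m≤m+n; m≤n+m; +-comm; +-monoˡ-≤; ∸-monoˡ-≤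
        ; m∸n≤m; m∸n+n≡m; m+n∸m≡n; m+[n∸m]≡n; [m+n]∸[m+o]≡n∸o; module ≤-Reasoning )
open import Data.Fin using (Fin; zero; suc; _↑ʳ_; fromℕ<)
open import Data.Fin.Subset using (Subset; inside; outside; ⊥; ⁅_⁆; _∩_; ∣_∣; _⊆_; _⊂_)
  renaming (_∈_ to _∈ˢ_)
open import Data.Fin.Subset.Properties
  using ( _⊆?_; ⊆-refl; ⊆-trans; ⊆-min; drop-∷-⊆; drop-∷-⊂; s⊆s; out⊆; s⊂s; out⊂in
        ; out⊆-⇔; in⊆in-⇔; out⊂out-⇔; out⊂in-⇔; in⊂in-⇔
        ; x∈⁅x⁆; x∈⁅y⁆⇒x≡y; ∣⁅x⁆∣≡1; ∣⊥∣≡0; p⊆q⇒∣p∣≤∣q∣; p∩q⊆p; p∩q⊆q; x∈p∩q⁺; x∈p∩q⁻ )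
open import Data.Vec using ([]; _∷_; here; there)
open import Data.List using (List; []; _∷_; map; _++_; length; filter; filterᵇ; concatMap)
open import Data.List.Properties using (length-++; filter-++)
open import Data.List.Membership.Propositional using (_∈_; lose; find)
open import Data.List.Membership.Propositional.Properties
  using (∈-++⁺ˡ; ∈-++⁺ʳ; ∈-map⁺; ∈-filter⁺; ∈-filter⁻; ∈-concatMap⁺; ∈-concatMap⁻)
open import Data.List.Relation.Unary.All as All using (All; []; _∷_)
import Data.List.Relation.Unary.All.Properties as All
open import Data.List.Relation.Unary.All.Properties using (all⁺; all⁻)
open import Data.List.Relation.Unary.Any as Any using (Any; here; satisfied)
import Data.List.Relation.Unary.Any.Properties as Any
open import Data.List.Relation.Unary.Any.Properties using (any⁺; any⁻)
import Data.List.Relation.Binary.Sublist.Propositional as Sublist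
import Data.List.Relation.Binary.Sublist.Propositional.Properties as Sublist
open import Data.Product using (∃; _×_; _,_; proj₁; proj₂)
open import Function using (id; _∘_; _⇔_; mk⇔; Equivalence; case_of_)
import Function.Properties.Equivalence as ⇔
open import Relation.Binary.PropositionalEquality
  using (_≡_; refl; sym; cong; cong₂; subst; subst₂; module ≡-Reasoning)
open import Relation.Nullary using (¬_; yes; no)
open import Relation.Nullary.Decidable using (T?; _×-dec_)
open import Relation.Unary using (Decidable)

open Equivalence using (to; from)

allSubsets-complete : ∀ {n} (S : Subset n) → S ∈ allSubsets n
allSubsets-complete []            = here refl
allSubsets-complete (inside ∷ S)  = ∈-++⁺ˡ (∈-map⁺ (inside ∷_) (allSubsets-complete S))
allSubsets-complete {suc n} (outside ∷ S) =
  ∈-++⁺ʳ (map (inside ∷_) (allSubsets n)) (∈-map⁺ (outside ∷_) (allSubsets-complete S))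

countSubsets : {n : ℕ} → (Subset n → Bool) → ℕ
countSubsets {n} p = length (filterᵇ p (allSubsets n))

countSubsets-mono : ∀ {n} (p q : Subset n → Bool) →
  (∀ S → T (p S) → T (q S)) → countSubsets p ≤ countSubsets q
countSubsets-mono {n} p q p⇒q = Sublist.length-mono-≤
  (Sublist.filter⁺ (T? ∘ p) (T? ∘ q) (λ { {S} refl → p⇒q S }) (Sublist.⊆-refl {x = allSubsets n}))

countSubsets-cong : ∀ {n} (p q : Subset n → Bool) →
  (∀ S → T (p S) ⇔ T (q S)) → countSubsets p ≡ countSubsets q
countSubsets-cong p q p⇔q = ≤-antisym
  (countSubsets-mono p q (to ∘ p⇔q)) (countSubsets-mono q p (from ∘ p⇔q))

length-filterᵇ-map : ∀ {A B : Set} (p : B → Bool) (f : A → B) xs →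
  length (filterᵇ p (map f xs)) ≡ length (filterᵇ (p ∘ f) xs)
length-filterᵇ-map p f []       = refl
length-filterᵇ-map p f (x ∷ xs) with p (f x)
... | true  = cong suc (length-filterᵇ-map p f xs)
... | false = length-filterᵇ-map p f xs

countSubsets-suc : ∀ {n} (p : Subset (suc n) → Bool) →
  countSubsets p ≡ countSubsets (p ∘ (inside ∷_)) + countSubsets (p ∘ (outside ∷_))
countSubsets-suc {n} p = begin
  length (filterᵇ p (map (inside ∷_) Ss ++ map (outside ∷_) Ss))
    ≡⟨ cong length (filter-++ (T? ∘ p) (map (inside ∷_) Ss) _) ⟩
  length (filterᵇ p (map (inside ∷_) Ss) ++ filterᵇ p (map (outside ∷_) Ss))
    ≡⟨ length-++ (filterᵇ p (map (inside ∷_) Ss)) ⟩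
  length (filterᵇ p (map (inside ∷_) Ss)) + length (filterᵇ p (map (outside ∷_) Ss))
    ≡⟨ cong₂ _+_ (length-filterᵇ-map p (inside ∷_) Ss) (length-filterᵇ-map p (outside ∷_) Ss) ⟩
  countSubsets (p ∘ (inside ∷_)) + countSubsets (p ∘ (outside ∷_)) ∎
  where
  open ≡-Reasoning
  Ss : List (Subset n)
  Ss = allSubsets n

countSubsets-∷ : ∀ {n} (b : Bool) (p : Subset n → Bool) (q : Subset (suc n) → Bool) →
  (∀ S → T (p S) → T (q (b ∷ S))) → countSubsets p ≤ countSubsets q
countSubsets-∷ b p q p⇒q = begin
  countSubsets p                   ≤⟨ countSubsets-mono p (q ∘ (b ∷_)) p⇒q ⟩
  countSubsets (q ∘ (b ∷_))        ≤⟨ summand b ⟩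
  countSubsets (q ∘ (inside ∷_))
    + countSubsets (q ∘ (outside ∷_)) ≡⟨ countSubsets-suc q ⟨
  countSubsets q                   ∎
  where
  open ≤-Reasoning
  summand : ∀ b → countSubsets (q ∘ (b ∷_)) ≤
                  countSubsets (q ∘ (inside ∷_)) + countSubsets (q ∘ (outside ∷_))
  summand true  = m≤m+n _ _
  summand false = m≤n+m _ _

T-not : ∀ {b} → T (not b) ⇔ (¬ T b)
T-not {true}  = mk⇔ (λ ()) (λ ¬t → ¬t _)
T-not {false} = mk⇔ (λ _ ()) _

T-⊆ᵇ : ∀ {n} {s t : Subset n} → T (s ⊆ᵇ t) ⇔ s ⊆ t
T-⊆ᵇ {s = []}          {[]}          = mk⇔ (λ _ ()) _
T-⊆ᵇ {s = outside ∷ s} {y ∷ t}       = ⇔.trans T-⊆ᵇ out⊆-⇔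
T-⊆ᵇ {s = inside ∷ s}  {outside ∷ t} = mk⇔ (λ ()) (λ s⊆t → case s⊆t here of λ ())
T-⊆ᵇ {s = inside ∷ s}  {inside ∷ t}  = ⇔.trans T-⊆ᵇ in⊆in-⇔

T-⊂ᵇ : ∀ {n} {s t : Subset n} → T (s ⊂ᵇ t) ⇔ s ⊂ t
T-⊂ᵇ {s = []}          {[]}          = mk⇔ (λ ()) (λ { (_ , () , _) })
T-⊂ᵇ {s = outside ∷ s} {outside ∷ t} = ⇔.trans T-⊂ᵇ out⊂out-⇔
T-⊂ᵇ {s = outside ∷ s} {inside ∷ t}  =
  ⇔.trans (⇔.trans T-∧ (mk⇔ proj₁ (_, _))) (⇔.trans T-⊆ᵇ out⊂in-⇔)
T-⊂ᵇ {s = inside ∷ s}  {outside ∷ t} = mk⇔ (λ ()) (λ s⊂t → case proj₁ s⊂t here of λ ())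
T-⊂ᵇ {s = inside ∷ s}  {inside ∷ t}  = ⇔.trans T-⊂ᵇ in⊂in-⇔

Transversal : {n : ℕ} → ℕ → Hypergraph n → Subset n → Set
Transversal a H S = All (λ e → ∣ e ∩ S ∣ ≤ a) H

MaximalTransversal : {n : ℕ} → ℕ → Hypergraph n → Subset n → Set
MaximalTransversal a H S = Transversal a H S × (∀ {S′} → S ⊂ S′ → ¬ Transversal a H S′)

T-IsTransversal : ∀ {n} a (H : Hypergraph n) S → T (IsTransversal a H S) ⇔ Transversal a H S
T-IsTransversal a H S = mk⇔ (All.map (≤ᵇ⇒≤ _ _) ∘ all⁺ _ H) (all⁻ _ ∘ All.map ≤⇒≤ᵇ)

T-IsMaximalTransversal : ∀ {n} a (H : Hypergraph n) S →
  T (IsMaximalTransversal a H S) ⇔ MaximalTransversal a H S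
T-IsMaximalTransversal {n} a H S = ⇔.trans T-∧ (mk⇔ to′ from′)
  where
  properTransversal : Subset n → Bool
  properTransversal S′ = (S ⊂ᵇ S′) ∧ IsTransversal a H S′

  to′ : T (IsTransversal a H S) × T (not (any properTransversal (allSubsets n))) →
        MaximalTransversal a H S
  to′ (tr , none) = to (T-IsTransversal a H S) tr , λ {S′} S⊂S′ trS′ →
    to T-not none (any⁺ properTransversal (lose (allSubsets-complete S′)
      (from T-∧ (from T-⊂ᵇ S⊂S′ , from (T-IsTransversal a H S′) trS′))))

  from′ : MaximalTransversal a H S →
          T (IsTransversal a H S) × T (not (any properTransversal (allSubsets n)))
  from′ (tr , maximal) = from (T-IsTransversal a H S) tr , from T-not λ some →
    let S′ , proper = satisfied (any⁻ properTransversal (allSubsets n) some)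
        S⊂S′ , trS′ = to T-∧ proper
    in maximal (to T-⊂ᵇ S⊂S′) (to (T-IsTransversal a H S′) trS′)

module _ {n a : ℕ} {H G : Hypergraph n} (H≈G : ∀ {S} → Transversal a H S ⇔ Transversal a G S) where

  MaximalTransversal-cong : ∀ {S} → MaximalTransversal a H S ⇔ MaximalTransversal a G S
  MaximalTransversal-cong = mk⇔
    (λ (tr , maximal) → to H≈G tr , λ S⊂S′ → maximal S⊂S′ ∘ from H≈G)
    (λ (tr , maximal) → from H≈G tr , λ S⊂S′ → maximal S⊂S′ ∘ to H≈G)

  numTransversals-cong : numTransversals a H ≡ numTransversals a G
  numTransversals-cong = countSubsets-cong (IsTransversal a H) (IsTransversal a G) λ S →
    ⇔.trans (T-IsTransversal a H S) (⇔.trans H≈G (⇔.sym (T-IsTransversal a G S)))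

  numMaximalTransversals-cong : numMaximalTransversals a H ≡ numMaximalTransversals a G
  numMaximalTransversals-cong =
    countSubsets-cong (IsMaximalTransversal a H) (IsMaximalTransversal a G) λ S →
      ⇔.trans (T-IsMaximalTransversal a H S)
        (⇔.trans MaximalTransversal-cong (⇔.sym (T-IsMaximalTransversal a G S)))

∩-mono-⊆ : ∀ {n} {p p′ q q′ : Subset n} → p ⊆ p′ → q ⊆ q′ → p ∩ q ⊆ p′ ∩ q′
∩-mono-⊆ p⊆p′ q⊆q′ x∈p∩q =
  let x∈p , x∈q = x∈p∩q⁻ _ _ x∈p∩q in x∈p∩q⁺ (p⊆p′ x∈p , q⊆q′ x∈q)

interpolant : ∀ {n} k (u s : Subset n) → u ⊆ s → ∣ u ∣ ≤ k → k ≤ ∣ s ∣ →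
  ∃ λ f → u ⊆ f × f ⊆ s × ∣ f ∣ ≡ k
interpolant zero    []            []            _   _         _         = [] , ⊆-refl , ⊆-refl , refl
interpolant (suc k) []            []            _   _         ()
interpolant k       (outside ∷ u) (outside ∷ s) u⊆s u≤k       k≤s       =
  let f , u⊆f , f⊆s , ∣f∣≡k = interpolant k u s (drop-∷-⊆ u⊆s) u≤k k≤s
  in outside ∷ f , s⊆s u⊆f , s⊆s f⊆s , ∣f∣≡k
interpolant k       (inside ∷ u)  (outside ∷ s) u⊆s _         _         = case u⊆s here of λ ()
interpolant (suc k) (inside ∷ u)  (inside ∷ s)  u⊆s (s≤s u≤k) (s≤s k≤s) =
  let f , u⊆f , f⊆s , ∣f∣≡k = interpolant k u s (drop-∷-⊆ u⊆s) u≤k k≤s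
  in inside ∷ f , s⊆s u⊆f , s⊆s f⊆s , cong suc ∣f∣≡k
interpolant k       (outside ∷ u) (inside ∷ s)  u⊆s u≤k       k≤s       with k ≤? ∣ s ∣
... | yes k≤∣s∣ =
  let f , u⊆f , f⊆s , ∣f∣≡k = interpolant k u s (drop-∷-⊆ u⊆s) u≤k k≤∣s∣
  in outside ∷ f , s⊆s u⊆f , out⊆ f⊆s , ∣f∣≡k
... | no  k≰∣s∣ = inside ∷ s , u⊆s , ⊆-refl , ≤-antisym (≰⇒> k≰∣s∣) k≤s

∣x∷p∣≤1+∣x∷q∣ : ∀ {n} x {p q : Subset n} → ∣ p ∣ ≤ suc ∣ q ∣ → ∣ x ∷ p ∣ ≤ suc ∣ x ∷ q ∣
∣x∷p∣≤1+∣x∷q∣ inside  = s≤s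
∣x∷p∣≤1+∣x∷q∣ outside = id

∃-one-vertex-extension : ∀ {n} (e S : Subset n) → ∣ e ∩ S ∣ < ∣ e ∣ →
  ∃ λ S′ → S ⊂ S′ × ∀ f → ∣ f ∩ S′ ∣ ≤ suc ∣ f ∩ S ∣
∃-one-vertex-extension (inside ∷ e) (outside ∷ S) _ = inside ∷ S , out⊂in ⊆-refl , one-more
  where
  one-more : ∀ f → ∣ f ∩ (inside ∷ S) ∣ ≤ suc ∣ f ∩ (outside ∷ S) ∣
  one-more (inside ∷ f)  = ≤-refl
  one-more (outside ∷ f) = n≤1+n _
∃-one-vertex-extension (inside ∷ e) (inside ∷ S) (s≤s e∩S<e) =
  let S′ , S⊂S′ , one-more = ∃-one-vertex-extension e S e∩S<e
  in inside ∷ S′ , s⊂s S⊂S′ , λ { (x ∷ f) → ∣x∷p∣≤1+∣x∷q∣ (x ∧ true) {f ∩ S′} {f ∩ S} (one-more f) }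
∃-one-vertex-extension (outside ∷ e) (y ∷ S) e∩S<e =
  let S′ , S⊂S′ , one-more = ∃-one-vertex-extension e S e∩S<e
  in y ∷ S′ , s⊂s S⊂S′ , λ { (x ∷ f) → ∣x∷p∣≤1+∣x∷q∣ (x ∧ y) {f ∩ S′} {f ∩ S} (one-more f) }

∃-subset-exceeding : ∀ {n} {a k} {e S : Subset n} → a < k → k ≤ ∣ e ∣ → a < ∣ e ∩ S ∣ →
  ∃ λ f → f ⊆ e × ∣ f ∣ ≡ k × a < ∣ f ∩ S ∣
∃-subset-exceeding {n} {a} {k} {e} {S} a<k k≤∣e∣ a<∣e∩S∣ =
  let u , _ , u⊆e∩S , ∣u∣≡1+a = interpolant (suc a) ⊥ (e ∩ S) (⊆-min (e ∩ S))
                                  (≤-trans (≤-reflexive (∣⊥∣≡0 n)) z≤n) a<∣e∩S∣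
      f , u⊆f , f⊆e , ∣f∣≡k = interpolant k u e (⊆-trans u⊆e∩S (p∩q⊆p e S))
                                (≤-trans (≤-reflexive ∣u∣≡1+a) a<k) k≤∣e∣
      u⊆f∩S : u ⊆ f ∩ S
      u⊆f∩S x∈u = x∈p∩q⁺ (u⊆f x∈u , p∩q⊆q e S (u⊆e∩S x∈u))
  in f , f⊆e , ∣f∣≡k , ≤-trans (≤-reflexive (sym ∣u∣≡1+a)) (p⊆q⇒∣p∣≤∣q∣ u⊆f∩S)

-- The k-shadow

k-subset-of? : ∀ {n} k (e : Subset n) → Decidable (λ f → f ⊆ e × ∣ f ∣ ≡ k)
k-subset-of? k e f = f ⊆? e ×-dec ∣ f ∣ ≟ k

kSubsets : ∀ {n} → ℕ → Subset n → List (Subset n)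
kSubsets {n} k e = filter (k-subset-of? k e) (allSubsets n)

shadow : ∀ {n} → ℕ → Hypergraph n → Hypergraph n
shadow k = concatMap (kSubsets k)

module _ {n k : ℕ} {H : Hypergraph n} {f : Subset n} where

  ∈-shadow⁺ : ∀ {e} → e ∈ H → f ⊆ e → ∣ f ∣ ≡ k → f ∈ shadow k H
  ∈-shadow⁺ e∈H f⊆e ∣f∣≡k =
    ∈-concatMap⁺ (kSubsets k)
      (lose e∈H (∈-filter⁺ (k-subset-of? k _) (allSubsets-complete f) (f⊆e , ∣f∣≡k)))

  ∈-shadow⁻ : f ∈ shadow k H → ∃ λ e → e ∈ H × f ⊆ e × ∣ f ∣ ≡ k
  ∈-shadow⁻ f∈shadow =
    let e , e∈H , f∈kSubsets = find (∈-concatMap⁻ (kSubsets k) {xs = H} f∈shadow)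
    in e , e∈H , proj₂ (∈-filter⁻ (k-subset-of? k e) {xs = allSubsets n} f∈kSubsets)

Uniform-shadow : ∀ {n} k (H : Hypergraph n) → Uniform k (shadow k H)
Uniform-shadow k H = All.tabulate λ f∈shadow →
  let _ , _ , _ , ∣f∣≡k = ∈-shadow⁻ {H = H} f∈shadow in ∣f∣≡k

NoIsolated-shadow : ∀ {n k} {H : Hypergraph n} → 1 ≤ k → All (λ e → k ≤ ∣ e ∣) H →
  NoIsolated H → NoIsolated (shadow k H)
NoIsolated-shadow {k = k} 1≤k k≤edges noIsolated v =
  let e , e∈H , v∈e = find (noIsolated v)
      f , ⁅v⁆⊆f , f⊆e , ∣f∣≡k = interpolant k ⁅ v ⁆ e (⁅v⁆⊆e v∈e)
        (≤-trans (≤-reflexive (∣⁅x⁆∣≡1 v)) 1≤k) (All.lookup k≤edges e∈H)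
  in lose (∈-shadow⁺ e∈H f⊆e ∣f∣≡k) (⁅v⁆⊆f (x∈⁅x⁆ v))
  where
  ⁅v⁆⊆e : ∀ {e} → v ∈ˢ e → ⁅ v ⁆ ⊆ e
  ⁅v⁆⊆e v∈e x∈⁅v⁆ = subst (_∈ˢ _) (sym (x∈⁅y⁆⇒x≡y v x∈⁅v⁆)) v∈e

Transversal-shadow : ∀ {n a k} {H : Hypergraph n} {S} → a < k → All (λ e → k ≤ ∣ e ∣) H →
  Transversal a (shadow k H) S ⇔ Transversal a H S
Transversal-shadow {a = a} {k} {H} {S} a<k k≤edges = mk⇔ to′ from′
  where
  to′ : Transversal a (shadow k H) S → Transversal a H S
  to′ tr = All.tabulate λ e∈H → ≮⇒≥ λ a<∣e∩S∣ →
    let f , f⊆e , ∣f∣≡k , a<∣f∩S∣ = ∃-subset-exceeding a<k (All.lookup k≤edges e∈H) a<∣e∩S∣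
    in <⇒≱ a<∣f∩S∣ (All.lookup tr (∈-shadow⁺ e∈H f⊆e ∣f∣≡k))

  from′ : Transversal a H S → Transversal a (shadow k H) S
  from′ tr = All.tabulate λ f∈shadow →
    let e , e∈H , f⊆e , _ = ∈-shadow⁻ {H = H} f∈shadow
    in ≤-trans (p⊆q⇒∣p∣≤∣q∣ (∩-mono-⊆ f⊆e ⊆-refl)) (All.lookup tr e∈H)

-- Cones

cone : ∀ {n} → Hypergraph n → Hypergraph (suc n)
cone = map (inside ∷_)

Uniform-cone : ∀ {n r} {H : Hypergraph n} → Uniform r H → Uniform (suc r) (cone H)
Uniform-cone = All.map⁺ ∘ All.map (cong suc)

-- The vertex only witnesses that H has an edge, which then covers the new vertex.
NoIsolated-cone : ∀ {n} {H : Hypergraph n} → Fin n → NoIsolated H → NoIsolated (cone H)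
NoIsolated-cone v noIsolated zero    = Any.map⁺ (Any.map (λ _ → here) (noIsolated v))
NoIsolated-cone v noIsolated (suc w) = Any.map⁺ (Any.map there (noIsolated w))

Transversal-cone-outside : ∀ {n a} {H : Hypergraph n} {S} →
  Transversal a (cone H) (outside ∷ S) ⇔ Transversal a H S
Transversal-cone-outside = mk⇔ All.map⁻ All.map⁺

numTransversals-cone : ∀ {n} a (H : Hypergraph n) → numTransversals a H ≤ numTransversals a (cone H)
numTransversals-cone a H =
  countSubsets-∷ outside (IsTransversal a H) (IsTransversal a (cone H)) λ S →
    from (T-IsTransversal a (cone H) (outside ∷ S)) ∘ from Transversal-cone-outside
      ∘ to (T-IsTransversal a H S)

MaximalTransversal⇒saturates : ∀ {n a j e} {H : Hypergraph n} {S} → Uniform j (e ∷ H) → a < j →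
  MaximalTransversal a (e ∷ H) S → Any (λ f → a ≤ ∣ f ∩ S ∣) (e ∷ H)
MaximalTransversal⇒saturates {a = a} {e = e} {H} {S} (∣e∣≡j ∷ _) a<j (tr , maximal) =
  let S′ , S⊂S′ , one-more = ∃-one-vertex-extension e S
        (≤-<-trans (All.head tr) (subst (a <_) (sym ∣e∣≡j) a<j))
      violated = All.¬All⇒Any¬ (λ f → ∣ f ∩ S′ ∣ ≤? a) (e ∷ H) (maximal S⊂S′)
  in Any.map (λ {f} ∣f∩S′∣≰a → ≤-pred (≤-trans (≰⇒> ∣f∩S′∣≰a) (one-more f))) violated

MaximalTransversal-cone-outside : ∀ {n a} {H : Hypergraph n} {S} → Any (λ e → a ≤ ∣ e ∩ S ∣) H →
  MaximalTransversal a H S → MaximalTransversal a (cone H) (outside ∷ S)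
MaximalTransversal-cone-outside {a = a} {H} {S} saturated (tr , maximal) =
  from Transversal-cone-outside tr , no-extension
  where
  no-extension : ∀ {S′} → outside ∷ S ⊂ S′ → ¬ Transversal a (cone H) S′
  no-extension {outside ∷ S′} S⊂S′ = maximal (drop-∷-⊂ S⊂S′) ∘ to Transversal-cone-outside
  no-extension {inside ∷ S′}  S⊂S′ tr′ =
    All.lookupWith (λ {e} → overfull {e}) (All.map⁻ tr′) saturated
    where
    overfull : ∀ {e} → suc ∣ e ∩ S′ ∣ ≤ a → ¬ a ≤ ∣ e ∩ S ∣
    overfull {e} ∣e∩S′∣<a a≤∣e∩S∣ = <⇒≱ ∣e∩S′∣<a
      (≤-trans a≤∣e∩S∣ (p⊆q⇒∣p∣≤∣q∣ (∩-mono-⊆ {p = e} ⊆-refl (from out⊂in-⇔ S⊂S′))))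

MaximalTransversal-empty-inside : ∀ {n a} {S : Subset n} →
  MaximalTransversal a [] S → MaximalTransversal a [] (inside ∷ S)
MaximalTransversal-empty-inside {a = a} {S} (_ , maximal) = [] , no-extension
  where
  no-extension : ∀ {S′} → inside ∷ S ⊂ S′ → ¬ Transversal a [] S′
  no-extension {outside ∷ S′} (S⊆S′ , _) = case S⊆S′ here of λ ()
  no-extension {inside ∷ S′}  S⊂S′ _     = maximal (drop-∷-⊂ S⊂S′) []

numMaximalTransversals-cone : ∀ {n a j} (H : Hypergraph n) → Uniform j H → a < j →
  numMaximalTransversals a H ≤ numMaximalTransversals a (cone H)
numMaximalTransversals-cone {n} {a} [] _ _ =
  countSubsets-∷ inside (IsMaximalTransversal a ([] {A = Subset n})) (IsMaximalTransversal a [])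
    λ S →
    from (T-IsMaximalTransversal a [] (inside ∷ S)) ∘ MaximalTransversal-empty-inside
      ∘ to (T-IsMaximalTransversal a [] S)
numMaximalTransversals-cone {a = a} H@(_ ∷ _) uniform a<j =
  countSubsets-∷ outside (IsMaximalTransversal a H) (IsMaximalTransversal a (cone H))
    λ S isMaximal →
      let maximal   = to (T-IsMaximalTransversal a H S) isMaximal
          saturated = MaximalTransversal⇒saturates uniform a<j maximal
      in from (T-IsMaximalTransversal a (cone H) (outside ∷ S))
           (MaximalTransversal-cone-outside saturated maximal)

cones : ∀ {n} d → Hypergraph n → Hypergraph (d + n)
cones zero    H = H
cones (suc d) H = cone (cones d H)

module _ {n : ℕ} {H : Hypergraph n} where

  Uniform-cones : ∀ {r} d → Uniform r H → Uniform (d + r) (cones d H)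
  Uniform-cones zero    uniform = uniform
  Uniform-cones (suc d) uniform = Uniform-cone (Uniform-cones d uniform)

  NoIsolated-cones : ∀ d → Fin n → NoIsolated H → NoIsolated (cones d H)
  NoIsolated-cones zero    v noIsolated = noIsolated
  NoIsolated-cones (suc d) v noIsolated = NoIsolated-cone (d ↑ʳ v) (NoIsolated-cones d v noIsolated)

  numTransversals-cones : ∀ a d → numTransversals a H ≤ numTransversals a (cones d H)
  numTransversals-cones a zero    = ≤-refl
  numTransversals-cones a (suc d) =
    ≤-trans (numTransversals-cones a d) (numTransversals-cone a (cones d H))

  numMaximalTransversals-cones : ∀ {a j} d → Uniform j H → a < j →
    numMaximalTransversals a H ≤ numMaximalTransversals a (cones d H)
  numMaximalTransversals-cones zero    _       _   = ≤-refl
  numMaximalTransversals-cones {j = j} (suc d) uniform a<j =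
    ≤-trans (numMaximalTransversals-cones d uniform a<j)
      (numMaximalTransversals-cone (cones d H) (Uniform-cones d uniform) (<-≤-trans a<j (m≤n+m j d)))

Uniform⇒All-≤ : ∀ {n k r} {H : Hypergraph n} → k ≤ r → Uniform r H → All (λ e → k ≤ ∣ e ∣) H
Uniform⇒All-≤ k≤r = All.map λ ∣e∣≡r → ≤-trans k≤r (≤-reflexive (sym ∣e∣≡r))

module _ {a k r n : ℕ} (a<k : a < k) (k≤r : k ≤ r) where

  IsG-≤-shadow : ∀ {g₁ g₂} → IsG k a n g₁ → IsG r a n g₂ → g₂ ≤ g₁
  IsG-≤-shadow (_ , g₁-bound) ((H , uniform , noIsolated , refl) , _) = begin
    numTransversals a H            ≡⟨ numTransversals-cong (Transversal-shadow a<k k≤edges) ⟨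
    numTransversals a (shadow k H) ≤⟨ g₁-bound (shadow k H) (Uniform-shadow k H)
                                        (NoIsolated-shadow (≤-<-trans z≤n a<k) k≤edges noIsolated) ⟩
    _                              ∎
    where
    open ≤-Reasoning
    k≤edges : All (λ e → k ≤ ∣ e ∣) H
    k≤edges = Uniform⇒All-≤ k≤r uniform

  IsH-≤-shadow : ∀ {h₁ h₂} → IsH k a n h₁ → IsH r a n h₂ → h₂ ≤ h₁
  IsH-≤-shadow (_ , h₁-bound) ((H , uniform , refl) , _) = begin
    numMaximalTransversals a H            ≡⟨ numMaximalTransversals-cong
                                               (Transversal-shadow a<k (Uniform⇒All-≤ k≤r uniform)) ⟨
    numMaximalTransversals a (shadow k H) ≤⟨ h₁-bound (shadow k H) (Uniform-shadow k H) ⟩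
    _                                     ∎
    where open ≤-Reasoning

IsG-≤-cones : ∀ {a k m d g₃ g₂} → Fin m → IsG k a m g₃ → IsG (d + k) a (d + m) g₂ → g₃ ≤ g₂
IsG-≤-cones {a = a} {d = d} v ((H , uniform , noIsolated , refl) , _) (_ , g₂-bound) =
  ≤-trans (numTransversals-cones a d)
    (g₂-bound (cones d H) (Uniform-cones d uniform) (NoIsolated-cones d v noIsolated))

IsH-≤-cones : ∀ {a k m d h₃ h₂} → a < k → IsH k a m h₃ → IsH (d + k) a (d + m) h₂ → h₃ ≤ h₂
IsH-≤-cones {d = d} a<k ((H , uniform , refl) , _) (_ , h₂-bound) =
  ≤-trans (numMaximalTransversals-cones d uniform a<k)
    (h₂-bound (cones d H) (Uniform-cones d uniform))

theorem4 : (a k r : ℕ) → a < k → k < r →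
    ((n : ℕ) → n ≥ r → (g₁ g₂ g₃ : ℕ) →
      IsG k a n g₁ → IsG r a n g₂ → IsG k a ((n + k) ∸ r) g₃ →
      g₂ ≤ g₁ × g₃ ≤ g₂)
    × ((n : ℕ) → n ≥ r ∸ k → (h₁ h₂ h₃ : ℕ) →
      IsH k a n h₁ → IsH r a n h₂ → IsH k a ((n + k) ∸ r) h₃ →
      h₂ ≤ h₁ × h₃ ≤ h₂)
theorem4 a k r a<k k<r =
  (λ n r≤n _ _ _ G₁ G₂ G₃ →
    IsG-≤-shadow a<k k≤r G₁ G₂ ,
    IsG-≤-cones (fromℕ< (<-≤-trans (≤-<-trans z≤n a<k) (k≤[n+k]∸r r≤n))) G₃
      (subst₂ (λ r n → IsG r a n _) (sym d+k≡r) (sym (d+[[n+k]∸r]≡n (≤-trans (m∸n≤m r k) r≤n))) G₂)) ,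
  (λ n d≤n _ _ _ H₁ H₂ H₃ →
    IsH-≤-shadow a<k k≤r H₁ H₂ ,
    IsH-≤-cones a<k H₃ (subst₂ (λ r n → IsH r a n _) (sym d+k≡r) (sym (d+[[n+k]∸r]≡n d≤n)) H₂))
  where
  k≤r : k ≤ r
  k≤r = <⇒≤ k<r

  d : ℕ
  d = r ∸ k

  d+k≡r : d + k ≡ r
  d+k≡r = m∸n+n≡m k≤r

  k≤[n+k]∸r : ∀ {n} → r ≤ n → k ≤ (n + k) ∸ r
  k≤[n+k]∸r r≤n = ≤-trans (≤-reflexive (sym (m+n∸m≡n r k))) (∸-monoˡ-≤ r (+-monoˡ-≤ k r≤n))

  d+[[n+k]∸r]≡n : ∀ {n} → d ≤ n → d + ((n + k) ∸ r) ≡ n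
  d+[[n+k]∸r]≡n {n} d≤n = begin
    d + ((n + k) ∸ r)       ≡⟨ cong (λ r → d + ((n + k) ∸ r)) d+k≡r ⟨
    d + ((n + k) ∸ (d + k)) ≡⟨ cong (d +_) (cong₂ _∸_ (+-comm n k) (+-comm d k)) ⟩
    d + ((k + n) ∸ (k + d)) ≡⟨ cong (d +_) ([m+n]∸[m+o]≡n∸o k n d) ⟩
    d + (n ∸ d)             ≡⟨ m+[n∸m]≡n d≤n ⟩
    n                       ∎
    where open ≡-Reasoning
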